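{- A cograph $G$ contains an induced cycle on four or more vertices if and only if every cotree of $G$ is not skew.
   Context: Cographs: a single vertex is a cograph; disjoint unions and joins (disjoint union plus all edges between distinct parts) of cographs are cographs. A cotree for a cograph $G$ is a rooted tree $T$ whose leaves correspond bijectively to the vertices of $G$ and whose internal nodes are labeled either $\oplus$ (join node, "1-node") or $\cup$ (union node, "0-node"), such that two distinct vertices of $G$ are adjacent if and only if the lowest common ancestor of the corresponding leaves in $T$ is a $\oplus$-node. A cotree $T$ is skew if for every $\oplus$-node of $T$, at most one of its children has some $\cup$-node as a descendant (a node counts as a descendant of itself). -}

module Defs where

open import Data.Nat using (ℕ; zero; suc; _+_; _∸_; _≤_)
open import Data.Fin using (Fin; toℕ; splitAt)
open import Data.Bool using (Bool; true; false)
open import Data.Sum using (_⊎_; inj₁; inj₂)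
open import Data.Product using (Σ; _×_; ∃; ∃-syntax)
open import Data.List using (List; []; _∷_; _++_; [_]; length; lookup)
open import Data.List.Membership.Propositional using (_∈_)
open import Data.List.Relation.Binary.Permutation.Propositional using (_↭_)
open import Data.List using () renaming (allFin to allFinL)
open import Function.Bundles using (_↔_; Inverse; _⇔_)
open import Function.Definitions using (Injective)
open import Relation.Binary.PropositionalEquality using (_≡_; _≢_)
open import Relation.Nullary using (¬_)

-- Graphs on vertex set Fin n, given by a Boolean adjacency function.
-- (Simplicity -- symmetry and looplessness -- is enforced by IsCograph.)

Graph : ℕ → Set
Graph n = Fin n → Fin n → Bool

K1 : Graph 1
K1 _ _ = false

_∪G_ : ∀ {m n} → Graph m → Graph n → Graph (m + n)
_∪G_ {m} G H x y with splitAt m x | splitAt m y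
... | inj₁ a | inj₁ b = G a b
... | inj₂ a | inj₂ b = H a b
... | inj₁ _ | inj₂ _ = false
... | inj₂ _ | inj₁ _ = false

_⊕G_ : ∀ {m n} → Graph m → Graph n → Graph (m + n)
_⊕G_ {m} G H x y with splitAt m x | splitAt m y
... | inj₁ a | inj₁ b = G a b
... | inj₂ a | inj₂ b = H a b
... | inj₁ _ | inj₂ _ = true
... | inj₂ _ | inj₁ _ = true

record _≅G_ {m n} (G : Graph m) (H : Graph n) : Set where
  field
    σ     : Fin m ↔ Fin n
    preserves : ∀ x y → H (Inverse.to σ x) (Inverse.to σ y) ≡ G x y

data IsCograph : ∀ {n} → Graph n → Set where
  single : IsCograph K1
  union  : ∀ {m n} {G : Graph m} {H : Graph n} →
           IsCograph G → IsCograph H → IsCograph (G ∪G H)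
  join   : ∀ {m n} {G : Graph m} {H : Graph n} →
           IsCograph G → IsCograph H → IsCograph (G ⊕G H)
  iso    : ∀ {m n} {G : Graph m} {H : Graph n} →
           G ≅G H → IsCograph G → IsCograph H

CycSucc : ∀ {k} → Fin k → Fin k → Set
CycSucc {k} i j = (toℕ j ≡ suc (toℕ i)) ⊎ ((toℕ i ≡ k ∸ 1) × (toℕ j ≡ 0))

CycAdj : ∀ {k} → Fin k → Fin k → Set
CycAdj i j = CycSucc i j ⊎ CycSucc j i

HasInducedCycle : ∀ {n} → Graph n → Set
HasInducedCycle {n} G =
  ∃[ k ] (4 ≤ k × Σ (Fin k → Fin n) λ f →
    Injective _≡_ _≡_ f ×
    (∀ i j → i ≢ j → ((G (f i) (f j) ≡ true) ⇔ CycAdj i j)))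

data Label : Set where
  joinN  : Label
  unionN : Label

-- rooted trees; internal nodes have a nonempty list of children
-- (first child c, remaining children cs); leaves carry a vertex
data CoTree (n : ℕ) : Set where
  leaf : Fin n → CoTree n
  node : Label → CoTree n → List (CoTree n) → CoTree n

mutual
  leaves : ∀ {n} → CoTree n → List (Fin n)
  leaves (leaf x) = [ x ]
  leaves (node _ c cs) = leaves c ++ leavesL cs

  leavesL : ∀ {n} → List (CoTree n) → List (Fin n)
  leavesL [] = []
  leavesL (t ∷ ts) = leaves t ++ leavesL ts

-- LCA t u v ℓ : the lowest common ancestor of leaves u, v in t has label ℓ
data LCA {n} : CoTree n → Fin n → Fin n → Label → Set where
  split : ∀ {ℓ c cs u v} (i j : Fin (length (c ∷ cs))) → i ≢ j →
          u ∈ leaves (lookup (c ∷ cs) i) → v ∈ leaves (lookup (c ∷ cs) j) →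
          LCA (node ℓ c cs) u v ℓ
  down  : ∀ {ℓ ℓ′ c cs u v t} → t ∈ (c ∷ cs) → LCA t u v ℓ′ →
          LCA (node ℓ c cs) u v ℓ′

record IsCotree {n} (G : Graph n) (T : CoTree n) : Set where
  field
    bijective : leaves T ↭ allFinL n
    adjacency : ∀ u v → u ≢ v → ((G u v ≡ true) ⇔ LCA T u v joinN)

data _⊑_ {n} : CoTree n → CoTree n → Set where
  here  : ∀ {t} → t ⊑ t
  child : ∀ {s t ℓ c cs} → t ∈ (c ∷ cs) → s ⊑ t → s ⊑ node ℓ c cs

HasUnion : ∀ {n} → CoTree n → Set
HasUnion t = ∃[ c ] ∃[ cs ] (node unionN c cs ⊑ t)

Skew : ∀ {n} → CoTree n → Set
Skew T = ∀ c cs → node joinN c cs ⊑ T →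
  ∀ (i j : Fin (length (c ∷ cs))) →
  HasUnion (lookup (c ∷ cs) i) → HasUnion (lookup (c ∷ cs) j) → i ≡ j

module Submission where

open import Defs
open import Data.Nat using (ℕ; _+_; s≤s; z≤n)
open import Data.Fin using (Fin; zero; suc; splitAt; _↑ˡ_; _↑ʳ_)
open import Data.Fin.Properties
  using (splitAt-↑ˡ; splitAt-↑ʳ; splitAt⁻¹-↑ˡ; splitAt⁻¹-↑ʳ; ↑ˡ-injective; ↑ʳ-injective; suc-injective;
         any?; _≟_)
open import Data.Bool using (Bool; true; false)
open import Data.Bool.Properties using () renaming (_≟_ to _≟ᵇ_)
open import Data.Sum using (_⊎_; inj₁; inj₂)
open import Data.Product using (_×_; ∃-syntax; _,_; proj₁; proj₂)
open import Data.List using (List; []; _∷_; _++_; length; lookup; map; allFin)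
open import Data.List.Properties using (map-++; map-∘; map-id; ++-identityʳ)
open import Data.List.Relation.Unary.Any using (here; there; index)
open import Data.List.Relation.Unary.Any.Properties using (lookup-index)
open import Data.List.Relation.Unary.All using (All; []; _∷_) renaming (lookup to All-lookup)
open import Data.List.Relation.Unary.All.Properties using (++⁻ˡ)
open import Data.List.Relation.Unary.AllPairs using ([]; _∷_)
open import Data.List.Relation.Unary.Unique.Propositional using (Unique)
open import Data.List.Relation.Unary.Unique.Propositional.Properties using (allFin⁺)
  renaming (map⁺ to Unique-map⁺; ++⁺ to Unique-++⁺)
open import Data.List.Membership.Propositional using (_∈_)
open import Data.List.Membership.Propositional.Properties
  using (∈-map⁺; ∈-map⁻; ∈-++⁺ˡ; ∈-++⁺ʳ; ∈-++⁻; ∈-lookup; ∈-allFin)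
open import Data.List.Membership.Propositional.Properties.WithK using (unique∧set⇒bag)
open import Data.List.Relation.Binary.BagAndSetEquality using (∼bag⇒↭)
open import Data.List.Relation.Binary.Permutation.Propositional
  using (_↭_; ↭-sym; ↭-trans; ↭-refl; ↭⇒↭ₛ)
open import Data.List.Relation.Binary.Permutation.Propositional.Properties
  using (∈-resp-↭; ++-comm) renaming (map⁺ to ↭-map⁺; ++⁺ to ↭-++⁺)
import Data.List.Relation.Binary.Permutation.Setoid.Properties as Permutationₛ
open import Data.Empty using (⊥; ⊥-elim)
open import Function.Bundles using (_↔_; Inverse; Injection; _⇔_; mk⇔; module Equivalence)
open import Function.Properties.Inverse using (Inverse⇒Injection)
open import Function.Definitions using (Injective)
open import Relation.Binary.PropositionalEquality
  using (_≡_; _≢_; refl; sym; trans; cong; subst; subst₂; setoid)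
open import Relation.Nullary using (¬_; yes; no; ¬?)
open import Relation.Nullary.Decidable using (_×-dec_)

open Equivalence using (to; from)

-- Induced cycle ⇒ no skew cotree: four consecutive cycle vertices a b c d form an induced
-- path, and in a cotree whose leaves are distinct the ⊕-node at which b and c separate has
-- two children containing ∪-nodes, namely the lowest common ancestors of a, c and of b, d.
-- No induced cycle ⇒ a skew cotree, built along the construction of the cograph: at a join
-- of G and H, non-edges ab of G and cd of H would make a c b d an induced 4-cycle, so one
-- side is complete and is hung as leaves below a ⊕-node over the skew cotree of the other.

Unique-resp-↭ : ∀ {A : Set} {xs ys : List A} → xs ↭ ys → Unique xs → Unique ys
Unique-resp-↭ {A} p = Permutationₛ.Unique-resp-↭ (setoid A) (↭⇒↭ₛ p)

Unique-++⁻ˡ : ∀ {A : Set} (xs : List A) {ys} → Unique (xs ++ ys) → Unique xs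
Unique-++⁻ˡ []       _          = []
Unique-++⁻ˡ (x ∷ xs) (x∉ ∷ xs!) = ++⁻ˡ xs x∉ ∷ Unique-++⁻ˡ xs xs!

Unique-++⁻ʳ : ∀ {A : Set} (xs : List A) {ys} → Unique (xs ++ ys) → Unique ys
Unique-++⁻ʳ []       ys!      = ys!
Unique-++⁻ʳ (x ∷ xs) (_ ∷ !) = Unique-++⁻ʳ xs !

Unique-++⇒disjoint : ∀ {A : Set} (xs : List A) {ys} {z} → Unique (xs ++ ys) → z ∈ xs → z ∈ ys → ⊥
Unique-++⇒disjoint (x ∷ xs) (x∉ ∷ _) (here refl) z∈ys = All-lookup x∉ (∈-++⁺ʳ xs z∈ys) refl
Unique-++⇒disjoint (x ∷ xs) (_ ∷ !)  (there z∈xs) z∈ys = Unique-++⇒disjoint xs ! z∈xs z∈ys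

unique∧set⇒↭ : ∀ {A : Set} {xs ys : List A} → Unique xs → Unique ys →
               (∀ {z} → (z ∈ xs) ⇔ (z ∈ ys)) → xs ↭ ys
unique∧set⇒↭ xs! ys! xs⇔ys = ∼bag⇒↭ (unique∧set⇒bag xs! ys! xs⇔ys)

-- Leaves and lowest common ancestors in cotrees

∈-leavesL⁺ : ∀ {n} {t : CoTree n} {ts u} → t ∈ ts → u ∈ leaves t → u ∈ leavesL ts
∈-leavesL⁺ {ts = _ ∷ _}  (here refl) u∈t = ∈-++⁺ˡ u∈t
∈-leavesL⁺ {ts = t ∷ _} (there t∈ts) u∈t = ∈-++⁺ʳ (leaves t) (∈-leavesL⁺ t∈ts u∈t)

∈-leavesL⁻ : ∀ {n} (ts : List (CoTree n)) {u} → u ∈ leavesL ts → ∃[ i ] u ∈ leaves (lookup ts i)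
∈-leavesL⁻ (t ∷ ts) u∈ts with ∈-++⁻ (leaves t) u∈ts
... | inj₁ u∈t = zero , u∈t
... | inj₂ u∈ts′ with ∈-leavesL⁻ ts u∈ts′
...   | i , u∈tᵢ = suc i , u∈tᵢ

∈-leaves-lookup-index : ∀ {n} {t : CoTree n} {ts u} (t∈ts : t ∈ ts) →
                        u ∈ leaves t → u ∈ leaves (lookup ts (index t∈ts))
∈-leaves-lookup-index t∈ts = subst (λ s → _ ∈ leaves s) (lookup-index t∈ts)

index-injective : ∀ {n} {t t′ : CoTree n} {ts} (t∈ts : t ∈ ts) (t′∈ts : t′ ∈ ts) →
                  index t∈ts ≡ index t′∈ts → t ≡ t′
index-injective {ts = ts} t∈ts t′∈ts eq =
  trans (lookup-index t∈ts) (trans (cong (lookup ts) eq) (sym (lookup-index t′∈ts)))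

Unique-leaves-child : ∀ {n} {t : CoTree n} {ts} → t ∈ ts → Unique (leavesL ts) → Unique (leaves t)
Unique-leaves-child {ts = t ∷ _} (here refl)  ! = Unique-++⁻ˡ (leaves t) !
Unique-leaves-child {ts = t ∷ _} (there t∈ts) ! = Unique-leaves-child t∈ts (Unique-++⁻ʳ (leaves t) !)

leaf-child-unique : ∀ {n} (ts : List (CoTree n)) → Unique (leavesL ts) →
                    ∀ {u} (i j : Fin (length ts)) →
                    u ∈ leaves (lookup ts i) → u ∈ leaves (lookup ts j) → i ≡ j
leaf-child-unique (t ∷ ts) ! zero    zero    _ _ = refl
leaf-child-unique (t ∷ ts) ! zero    (suc j) p q =
  ⊥-elim (Unique-++⇒disjoint (leaves t) ! p (∈-leavesL⁺ (∈-lookup {xs = ts} j) q))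
leaf-child-unique (t ∷ ts) ! (suc i) zero    p q =
  ⊥-elim (Unique-++⇒disjoint (leaves t) ! q (∈-leavesL⁺ (∈-lookup {xs = ts} i) p))
leaf-child-unique (t ∷ ts) ! (suc i) (suc j) p q =
  cong suc (leaf-child-unique ts (Unique-++⁻ʳ (leaves t) !) i j p q)

LCA-leaves : ∀ {n} {t : CoTree n} {u v ℓ} → LCA t u v ℓ → u ∈ leaves t × v ∈ leaves t
LCA-leaves {t = node _ c cs} (split i j _ u∈ v∈) =
  ∈-leavesL⁺ (∈-lookup {xs = c ∷ cs} i) u∈ , ∈-leavesL⁺ (∈-lookup {xs = c ∷ cs} j) v∈
LCA-leaves (down t∈ lca) =
  ∈-leavesL⁺ t∈ (proj₁ (LCA-leaves lca)) , ∈-leavesL⁺ t∈ (proj₂ (LCA-leaves lca))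

LCA-sym : ∀ {n} {t : CoTree n} {u v ℓ} → LCA t u v ℓ → LCA t v u ℓ
LCA-sym (split i j i≢j u∈ v∈) = split j i (λ j≡i → i≢j (sym j≡i)) v∈ u∈
LCA-sym (down t∈ lca)         = down t∈ (LCA-sym lca)

mutual
  LCA-exists : ∀ {n} (t : CoTree n) {u v} → u ∈ leaves t → v ∈ leaves t → u ≢ v →
               ∃[ ℓ ] LCA t u v ℓ
  LCA-exists (leaf x) (here refl) (here refl) u≢v = ⊥-elim (u≢v refl)
  LCA-exists (node ℓ c cs) u∈ v∈ u≢v with ∈-leavesL⁻ (c ∷ cs) u∈ | ∈-leavesL⁻ (c ∷ cs) v∈
  ... | i , u∈tᵢ | j , v∈tⱼ with i ≟ j
  ...   | no i≢j   = ℓ , split i j i≢j u∈tᵢ v∈tⱼ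
  ...   | yes refl with LCA-exists-lookup c cs i u∈tᵢ v∈tⱼ u≢v
  ...     | ℓ′ , lca = ℓ′ , down (∈-lookup {xs = c ∷ cs} i) lca

  LCA-exists-lookup : ∀ {n} (c : CoTree n) cs (i : Fin (length (c ∷ cs))) {u v} →
                      u ∈ leaves (lookup (c ∷ cs) i) → v ∈ leaves (lookup (c ∷ cs) i) → u ≢ v →
                      ∃[ ℓ ] LCA (lookup (c ∷ cs) i) u v ℓ
  LCA-exists-lookup c cs       zero    = LCA-exists c
  LCA-exists-lookup c (d ∷ cs) (suc i) = LCA-exists-lookup d cs i

LCA-unionN⇒HasUnion : ∀ {n} {t : CoTree n} {u v} → LCA t u v unionN → HasUnion t
LCA-unionN⇒HasUnion {t = node _ c cs} (split _ _ _ _ _) = c , cs , here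
LCA-unionN⇒HasUnion (down t∈ lca) with LCA-unionN⇒HasUnion lca
... | c , cs , ⊑t = c , cs , child t∈ ⊑t

LCA-node-inv : ∀ {n ℓ ℓ′} {c : CoTree n} {cs t u v} →
               Unique (leavesL (c ∷ cs)) → (t∈ : t ∈ c ∷ cs) → v ∈ leaves t →
               LCA (node ℓ c cs) u v ℓ′ →
               LCA t u v ℓ′ ⊎ (ℓ ≡ ℓ′ × ¬ u ∈ leaves t)
LCA-node-inv {c = c} {cs = cs} {t = t} {u = u} ! t∈ v∈t (split i j i≢j u∈ v∈) = inj₂ (refl , u∉t)
  where
  u∉t : ¬ u ∈ leaves t
  u∉t u∈t = i≢j (trans (leaf-child-unique (c ∷ cs) ! i (index t∈) u∈ (∈-leaves-lookup-index t∈ u∈t))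
                       (leaf-child-unique (c ∷ cs) ! (index t∈) j (∈-leaves-lookup-index t∈ v∈t) v∈))
LCA-node-inv {c = c} {cs} ! t∈ v∈t (down t′∈ lca) =
  inj₁ (subst (λ s → LCA s _ _ _) (index-injective t′∈ t∈ same-child) lca)
  where
  same-child = leaf-child-unique (c ∷ cs) ! (index t′∈) (index t∈)
                 (∈-leaves-lookup-index t′∈ (proj₂ (LCA-leaves lca))) (∈-leaves-lookup-index t∈ v∈t)

-- If either LCA were the node itself, u would lie outside t, so both would be the node,
-- which cannot carry both labels.
LCA-joinN-unionN-inChild : ∀ {n ℓ} {c : CoTree n} {cs t u v w} →
  Unique (leavesL (c ∷ cs)) → t ∈ c ∷ cs → v ∈ leaves t → w ∈ leaves t →
  LCA (node ℓ c cs) u v joinN → LCA (node ℓ c cs) u w unionN →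
  LCA t u v joinN × LCA t u w unionN
LCA-joinN-unionN-inChild ! t∈ v∈t w∈t uv uw
  with LCA-node-inv ! t∈ v∈t uv | LCA-node-inv ! t∈ w∈t uw
... | inj₁ uv′ | inj₁ uw′ = uv′ , uw′
... | inj₁ uv′ | inj₂ (_ , u∉t) = ⊥-elim (u∉t (proj₁ (LCA-leaves uv′)))
... | inj₂ (_ , u∉t) | inj₁ uw′ = ⊥-elim (u∉t (proj₁ (LCA-leaves uw′)))
... | inj₂ (refl , _) | inj₂ (() , _)

-- An induced cycle rules out skew cotrees

CycAdj-sym : ∀ {k} {i j : Fin k} → CycAdj i j → CycAdj j i
CycAdj-sym (inj₁ i→j) = inj₂ i→j
CycAdj-sym (inj₂ j→i) = inj₁ j→i

¬CycAdj-0-2 : ∀ {k} → ¬ CycAdj {4 + k} zero (suc (suc zero))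
¬CycAdj-0-2 (inj₁ (inj₁ ()))
¬CycAdj-0-2 (inj₁ (inj₂ (() , _)))
¬CycAdj-0-2 (inj₂ (inj₁ ()))
¬CycAdj-0-2 (inj₂ (inj₂ (() , _)))

¬CycAdj-1-3 : ∀ {k} → ¬ CycAdj {4 + k} (suc zero) (suc (suc (suc zero)))
¬CycAdj-1-3 (inj₁ (inj₁ ()))
¬CycAdj-1-3 (inj₁ (inj₂ (() , _)))
¬CycAdj-1-3 (inj₂ (inj₁ ()))
¬CycAdj-1-3 (inj₂ (inj₂ (_ , ())))

SkewViolation : ∀ {n} → CoTree n → Set
SkewViolation T = ∃[ c ] ∃[ cs ] (node joinN c cs ⊑ T ×
  ∃[ i ] ∃[ j ] (i ≢ j × HasUnion (lookup (c ∷ cs) i) × HasUnion (lookup (c ∷ cs) j)))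

SkewViolation⇒¬Skew : ∀ {n} {T : CoTree n} → SkewViolation T → ¬ Skew T
SkewViolation⇒¬Skew (c , cs , ⊑T , i , j , i≢j , uᵢ , uⱼ) skew = i≢j (skew c cs ⊑T i j uᵢ uⱼ)

SkewViolation-child : ∀ {n ℓ} {c : CoTree n} {cs t} → t ∈ c ∷ cs →
                      SkewViolation t → SkewViolation (node ℓ c cs)
SkewViolation-child t∈ (c , cs , ⊑t , rest) = c , cs , child t∈ ⊑t , rest

inducedP₄⇒SkewViolation : ∀ {n} {t : CoTree n} {a b c d} → Unique (leaves t) →
  LCA t a b joinN → LCA t b c joinN → LCA t c d joinN →
  LCA t a c unionN → LCA t b d unionN → SkewViolation t
inducedP₄⇒SkewViolation {t = node .joinN c₀ cs} ! _ (split i j i≢j b∈ c∈) _ (down t∈ ac) (down t′∈ bd)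
  =
  c₀ , cs , here , index t∈ , index t′∈ , children-differ ,
  subst HasUnion (lookup-index t∈) (LCA-unionN⇒HasUnion ac) ,
  subst HasUnion (lookup-index t′∈) (LCA-unionN⇒HasUnion bd)
  where
  c-child : index t∈ ≡ j
  c-child = leaf-child-unique (c₀ ∷ cs) ! (index t∈) j
              (∈-leaves-lookup-index t∈ (proj₂ (LCA-leaves ac))) c∈
  b-child : index t′∈ ≡ i
  b-child = leaf-child-unique (c₀ ∷ cs) ! (index t′∈) i
              (∈-leaves-lookup-index t′∈ (proj₁ (LCA-leaves bd))) b∈
  children-differ : index t∈ ≢ index t′∈
  children-differ eq = i≢j (trans (sym b-child) (trans (sym eq) c-child))
inducedP₄⇒SkewViolation {t = node ℓ c₀ cs} ! ab (down t∈ bc) cd ac bd =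
  SkewViolation-child t∈
    (inducedP₄⇒SkewViolation (Unique-leaves-child t∈ !) ab′ bc (LCA-sym dc′) ac′ (LCA-sym db′))
  where
  b∈t = proj₁ (LCA-leaves bc)
  c∈t = proj₂ (LCA-leaves bc)
  ab∧ac = LCA-joinN-unionN-inChild ! t∈ b∈t c∈t ab ac
  dc∧db = LCA-joinN-unionN-inChild ! t∈ c∈t b∈t (LCA-sym cd) (LCA-sym bd)
  ab′ = proj₁ ab∧ac
  ac′ = proj₂ ab∧ac
  dc′ = proj₁ dc∧db
  db′ = proj₂ dc∧db

HasInducedCycle⇒¬Skew : ∀ {n} {G : Graph n} → HasInducedCycle G → ∀ T → IsCotree G T → ¬ Skew T
HasInducedCycle⇒¬Skew {n} {G} (k , s≤s (s≤s (s≤s (s≤s _))) , g , g-inj , cycle) T cotree =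
  SkewViolation⇒¬Skew
    (inducedP₄⇒SkewViolation distinct
      (edge 0F 1F (λ ()) (inj₁ (inj₁ refl)))
      (edge 1F 2F (λ ()) (inj₁ (inj₁ refl)))
      (edge 2F 3F (λ ()) (inj₁ (inj₁ refl)))
      (nonEdge 0F 2F (λ ()) ¬CycAdj-0-2)
      (nonEdge 1F 3F (λ ()) ¬CycAdj-1-3))
  where
  open IsCotree cotree
  0F 1F 2F 3F : Fin k
  0F = zero
  1F = suc zero
  2F = suc (suc zero)
  3F = suc (suc (suc zero))
  distinct : Unique (leaves T)
  distinct = Unique-resp-↭ (↭-sym bijective) (allFin⁺ n)
  ∈-leaves : ∀ x → x ∈ leaves T
  ∈-leaves x = ∈-resp-↭ (↭-sym bijective) (∈-allFin x)
  g≢ : ∀ {i j} → i ≢ j → g i ≢ g j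
  g≢ i≢j eq = i≢j (g-inj eq)
  edge : ∀ i j → (i≢j : i ≢ j) → CycAdj i j → LCA T (g i) (g j) joinN
  edge i j i≢j i~j = to (adjacency (g i) (g j) (g≢ i≢j)) (from (cycle i j i≢j) i~j)
  nonEdge : ∀ i j → (i≢j : i ≢ j) → ¬ CycAdj i j → LCA T (g i) (g j) unionN
  nonEdge i j i≢j ¬i~j with LCA-exists T (∈-leaves (g i)) (∈-leaves (g j)) (g≢ i≢j)
  ... | unionN , lca = lca
  ... | joinN  , lca = ⊥-elim (¬i~j (to (cycle i j i≢j) (from (adjacency (g i) (g j) (g≢ i≢j)) lca)))

-- The two halves of Fin (m + n)

data SplitView (m n : ℕ) : Fin (m + n) → Set where
  left  : ∀ a → SplitView m n (a ↑ˡ n)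
  right : ∀ c → SplitView m n (m ↑ʳ c)

splitView : ∀ m n (x : Fin (m + n)) → SplitView m n x
splitView m n x with splitAt m x in eq
... | inj₁ a = subst (SplitView m n) (splitAt⁻¹-↑ˡ eq) (left a)
... | inj₂ c = subst (SplitView m n) (splitAt⁻¹-↑ʳ eq) (right c)

↑ˡ≢↑ʳ : ∀ m n (a : Fin m) (c : Fin n) → a ↑ˡ n ≢ m ↑ʳ c
↑ˡ≢↑ʳ m n a c eq with trans (sym (splitAt-↑ˡ m a n)) (trans (cong (splitAt m) eq) (splitAt-↑ʳ m n c))
... | ()

↑ˡ++↑ʳ↭allFin : ∀ m n → map (_↑ˡ n) (allFin m) ++ map (m ↑ʳ_) (allFin n) ↭ allFin (m + n)
↑ˡ++↑ʳ↭allFin m n = unique∧set⇒↭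
  (Unique-++⁺ (Unique-map⁺ (↑ˡ-injective n _ _) (allFin⁺ m))
               (Unique-map⁺ (↑ʳ-injective m _ _) (allFin⁺ n)) disjoint)
  (allFin⁺ (m + n))
  (λ {z} → mk⇔ (λ _ → ∈-allFin z) (λ _ → covered (splitView m n z)))
  where
  disjoint : ∀ {z} → ¬ (z ∈ map (_↑ˡ n) (allFin m) × z ∈ map (m ↑ʳ_) (allFin n))
  disjoint (z∈ˡ , z∈ʳ) with ∈-map⁻ (_↑ˡ n) z∈ˡ | ∈-map⁻ (m ↑ʳ_) z∈ʳ
  ... | a , _ , refl | c , _ , eq = ↑ˡ≢↑ʳ m n a c eq
  covered : ∀ {z} → SplitView m n z → z ∈ map (_↑ˡ n) (allFin m) ++ map (m ↑ʳ_) (allFin n)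
  covered (left a)  = ∈-++⁺ˡ (∈-map⁺ (_↑ˡ n) (∈-allFin a))
  covered (right c) = ∈-++⁺ʳ (map (_↑ˡ n) (allFin m)) (∈-map⁺ (m ↑ʳ_) (∈-allFin c))

map-↑ˡ++map-↑ʳ↭map : ∀ {m n N} (f : Fin (m + n) → Fin N) →
  map f (map (_↑ˡ n) (allFin m)) ++ map f (map (m ↑ʳ_) (allFin n)) ↭ map f (allFin (m + n))
map-↑ˡ++map-↑ʳ↭map {m} {n} f =
  subst (_↭ map f (allFin (m + n))) (map-++ f (map (_↑ˡ n) (allFin m)) (map (m ↑ʳ_) (allFin n)))
        (↭-map⁺ f (↑ˡ++↑ʳ↭allFin m n))

↔-injective : ∀ {m n} (σ : Fin m ↔ Fin n) → Injective _≡_ _≡_ (Inverse.to σ)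
↔-injective σ = Injection.injective (Inverse⇒Injection σ)

map-↔↭allFin : ∀ {m n} (σ : Fin m ↔ Fin n) → map (Inverse.to σ) (allFin m) ↭ allFin n
map-↔↭allFin {m} σ = unique∧set⇒↭ (Unique-map⁺ (↔-injective σ) (allFin⁺ m)) (allFin⁺ _)
  (λ {z} → mk⇔ (λ _ → ∈-allFin z)
    (λ _ → subst (_∈ map (Inverse.to σ) (allFin m)) (Inverse.strictlyInverseˡ σ z)
                 (∈-map⁺ (Inverse.to σ) (∈-allFin (Inverse.from σ z)))))

module _ {m n} (G : Graph m) (H : Graph n) where

  ∪G-ll : ∀ a b → (G ∪G H) (a ↑ˡ n) (b ↑ˡ n) ≡ G a b
  ∪G-ll a b rewrite splitAt-↑ˡ m a n | splitAt-↑ˡ m b n = refl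

  ∪G-rr : ∀ c d → (G ∪G H) (m ↑ʳ c) (m ↑ʳ d) ≡ H c d
  ∪G-rr c d rewrite splitAt-↑ʳ m n c | splitAt-↑ʳ m n d = refl

  ∪G-lr : ∀ a d → (G ∪G H) (a ↑ˡ n) (m ↑ʳ d) ≡ false
  ∪G-lr a d rewrite splitAt-↑ˡ m a n | splitAt-↑ʳ m n d = refl

  ∪G-rl : ∀ c b → (G ∪G H) (m ↑ʳ c) (b ↑ˡ n) ≡ false
  ∪G-rl c b rewrite splitAt-↑ʳ m n c | splitAt-↑ˡ m b n = refl

  ⊕G-ll : ∀ a b → (G ⊕G H) (a ↑ˡ n) (b ↑ˡ n) ≡ G a b
  ⊕G-ll a b rewrite splitAt-↑ˡ m a n | splitAt-↑ˡ m b n = refl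

  ⊕G-rr : ∀ c d → (G ⊕G H) (m ↑ʳ c) (m ↑ʳ d) ≡ H c d
  ⊕G-rr c d rewrite splitAt-↑ʳ m n c | splitAt-↑ʳ m n d = refl

  ⊕G-lr : ∀ a d → (G ⊕G H) (a ↑ˡ n) (m ↑ʳ d) ≡ true
  ⊕G-lr a d rewrite splitAt-↑ˡ m a n | splitAt-↑ʳ m n d = refl

  ⊕G-rl : ∀ c b → (G ⊕G H) (m ↑ʳ c) (b ↑ˡ n) ≡ true
  ⊕G-rl c b rewrite splitAt-↑ʳ m n c | splitAt-↑ˡ m b n = refl

-- Skew cotrees of cographs without induced cycles

data IsLeaf {n} : CoTree n → Set where
  isLeaf : ∀ x → IsLeaf (leaf x)

data SkewNF {n} : CoTree n → Set where
  nf-leaf  : ∀ x → SkewNF (leaf x)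
  nf-union : ∀ {c cs} → SkewNF c → All SkewNF cs → SkewNF (node unionN c cs)
  nf-join  : ∀ {c cs} → SkewNF c → All IsLeaf cs → SkewNF (node joinN c cs)

SkewNF-child : ∀ {n ℓ} {c : CoTree n} {cs t} → t ∈ c ∷ cs → SkewNF (node ℓ c cs) → SkewNF t
SkewNF-child (here refl)  (nf-union nfc _)  = nfc
SkewNF-child (there t∈cs) (nf-union _ nfcs) = All-lookup nfcs t∈cs
SkewNF-child (here refl)  (nf-join nfc _)   = nfc
SkewNF-child (there t∈cs) (nf-join _ leafs) with All-lookup leafs t∈cs
... | isLeaf x = nf-leaf x

SkewNF-⊑ : ∀ {n} {s t : CoTree n} → s ⊑ t → SkewNF t → SkewNF s
SkewNF-⊑ here          nf = nf
SkewNF-⊑ (child t∈ s⊑) nf = SkewNF-⊑ s⊑ (SkewNF-child t∈ nf)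

IsLeaf⇒¬HasUnion : ∀ {n} {t : CoTree n} → IsLeaf t → ¬ HasUnion t
IsLeaf⇒¬HasUnion (isLeaf x) (_ , _ , ())

HasUnion-child⇒first : ∀ {n} {c : CoTree n} {cs} → All IsLeaf cs →
                       (i : Fin (length (c ∷ cs))) → HasUnion (lookup (c ∷ cs) i) → i ≡ zero
HasUnion-child⇒first leafs        zero    _ = refl
HasUnion-child⇒first {cs = cs} leafs (suc i) u =
  ⊥-elim (IsLeaf⇒¬HasUnion (All-lookup leafs (∈-lookup {xs = cs} i)) u)

SkewNF⇒Skew : ∀ {n} {T : CoTree n} → SkewNF T → Skew T
SkewNF⇒Skew nf c cs ⊑T i j uᵢ uⱼ with SkewNF-⊑ ⊑T nf
... | nf-join _ leafs = trans (HasUnion-child⇒first leafs i uᵢ) (sym (HasUnion-child⇒first leafs j uⱼ))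

-- A skew cotree of G whose leaf for the vertex a is f a: the cotrees of the two parts of a
-- union or join are built directly over the vertex set of the whole graph.
record SkewCotree {m N} (G : Graph m) (f : Fin m → Fin N) (T : CoTree N) : Set where
  field
    leaves↭        : leaves T ↭ map f (allFin m)
    adjacent⇔joinN : ∀ a b → a ≢ b → (G a b ≡ true) ⇔ LCA T (f a) (f b) joinN
    skewNF         : SkewNF T
open SkewCotree

≡⇒true⇔ : ∀ {b b′ : Bool} {P : Set} → b ≡ b′ → (b′ ≡ true) ⇔ P → (b ≡ true) ⇔ P
≡⇒true⇔ refl b⇔P = b⇔P

∈-leaves⇒image : ∀ {m N} {A : Set} {f : A → Fin N} (g : Fin m → A) {xs : List (Fin N)} →
                 Injective _≡_ _≡_ f → xs ↭ map (λ a → f (g a)) (allFin m) →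
                 ∀ {x} → f x ∈ xs → ∃[ a ] x ≡ g a
∈-leaves⇒image {f = f} g f-inj xs↭ fx∈ with ∈-map⁻ (λ a → f (g a)) (∈-resp-↭ xs↭ fx∈)
... | a , _ , eq = a , f-inj eq

SkewCotree-K1 : ∀ {N} (f : Fin 1 → Fin N) → SkewCotree K1 f (leaf (f zero))
SkewCotree-K1 f = record { leaves↭ = ↭-refl ; adjacent⇔joinN = adjacent ; skewNF = nf-leaf _ }
  where
  adjacent : ∀ a b → a ≢ b → (K1 a b ≡ true) ⇔ LCA (leaf (f zero)) (f a) (f b) joinN
  adjacent zero zero a≢b = ⊥-elim (a≢b refl)

LCA-joinN-below-unionN : ∀ {n} {t₁ t₂ : CoTree n} {u v} →
  LCA (node unionN t₁ (t₂ ∷ [])) u v joinN → LCA t₁ u v joinN ⊎ LCA t₂ u v joinN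
LCA-joinN-below-unionN (down (here refl)         lca) = inj₁ lca
LCA-joinN-below-unionN (down (there (here refl)) lca) = inj₂ lca

SkewCotree-∪G : ∀ {m n N} {G : Graph m} {H : Graph n} (f : Fin (m + n) → Fin N) → Injective _≡_ _≡_ f →
  ∀ {T₁ T₂} → SkewCotree G (λ a → f (a ↑ˡ n)) T₁ → SkewCotree H (λ c → f (m ↑ʳ c)) T₂ →
  SkewCotree (G ∪G H) f (node unionN T₁ (T₂ ∷ []))
SkewCotree-∪G {m} {n} {G = G} {H} f f-inj {T₁} {T₂} ct₁ ct₂ = record
  { leaves↭        = ↭-trans (↭-++⁺ leaves₁↭ leaves₂↭) (map-↑ˡ++map-↑ʳ↭map {m} {n} f)
  ; adjacent⇔joinN = λ x y → adjacent (splitView m n x) (splitView m n y)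
  ; skewNF         = nf-union (skewNF ct₁) (skewNF ct₂ ∷ [])
  }
  where
  leaves₁↭ : leaves T₁ ↭ map f (map (_↑ˡ n) (allFin m))
  leaves₁↭ = subst (leaves T₁ ↭_) (map-∘ (allFin m)) (leaves↭ ct₁)
  leaves₂↭ : leaves T₂ ++ [] ↭ map f (map (m ↑ʳ_) (allFin n))
  leaves₂↭ = subst₂ _↭_ (sym (++-identityʳ (leaves T₂))) (map-∘ (allFin n)) (leaves↭ ct₂)
  ↑ˡ∉T₂ : ∀ a → ¬ f (a ↑ˡ n) ∈ leaves T₂
  ↑ˡ∉T₂ a fa∈ with ∈-leaves⇒image (m ↑ʳ_) f-inj (leaves↭ ct₂) fa∈
  ... | c , eq = ↑ˡ≢↑ʳ m n a c eq
  ↑ʳ∉T₁ : ∀ c → ¬ f (m ↑ʳ c) ∈ leaves T₁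
  ↑ʳ∉T₁ c fc∈ with ∈-leaves⇒image (_↑ˡ n) f-inj (leaves↭ ct₁) fc∈
  ... | a , eq = ↑ˡ≢↑ʳ m n a c (sym eq)
  T = node unionN T₁ (T₂ ∷ [])
  adjacent : ∀ {x y} → SplitView m n x → SplitView m n y → x ≢ y →
             ((G ∪G H) x y ≡ true) ⇔ LCA T (f x) (f y) joinN
  adjacent (left a) (left b) x≢y =
    ≡⇒true⇔ (∪G-ll G H a b) (mk⇔ (λ ab → down (here refl) (to G⇔ ab)) back)
    where
    G⇔ = adjacent⇔joinN ct₁ a b (λ a≡b → x≢y (cong (_↑ˡ n) a≡b))
    back : LCA T (f (a ↑ˡ n)) (f (b ↑ˡ n)) joinN → G a b ≡ true
    back lca with LCA-joinN-below-unionN lca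
    ... | inj₁ lca₁ = from G⇔ lca₁
    ... | inj₂ lca₂ = ⊥-elim (↑ˡ∉T₂ a (proj₁ (LCA-leaves lca₂)))
  adjacent (right c) (right d) x≢y =
    ≡⇒true⇔ (∪G-rr G H c d) (mk⇔ (λ cd → down (there (here refl)) (to H⇔ cd)) back)
    where
    H⇔ = adjacent⇔joinN ct₂ c d (λ c≡d → x≢y (cong (m ↑ʳ_) c≡d))
    back : LCA T (f (m ↑ʳ c)) (f (m ↑ʳ d)) joinN → H c d ≡ true
    back lca with LCA-joinN-below-unionN lca
    ... | inj₁ lca₁ = ⊥-elim (↑ʳ∉T₁ c (proj₁ (LCA-leaves lca₁)))
    ... | inj₂ lca₂ = from H⇔ lca₂
  adjacent (left a) (right d) _ = ≡⇒true⇔ (∪G-lr G H a d) (mk⇔ (λ ()) back)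
    where
    back : LCA T (f (a ↑ˡ n)) (f (m ↑ʳ d)) joinN → false ≡ true
    back lca with LCA-joinN-below-unionN lca
    ... | inj₁ lca₁ = ⊥-elim (↑ʳ∉T₁ d (proj₂ (LCA-leaves lca₁)))
    ... | inj₂ lca₂ = ⊥-elim (↑ˡ∉T₂ a (proj₁ (LCA-leaves lca₂)))
  adjacent (right c) (left b) _ = ≡⇒true⇔ (∪G-rl G H c b) (mk⇔ (λ ()) back)
    where
    back : LCA T (f (m ↑ʳ c)) (f (b ↑ˡ n)) joinN → false ≡ true
    back lca with LCA-joinN-below-unionN lca
    ... | inj₁ lca₁ = ⊥-elim (↑ʳ∉T₁ c (proj₁ (LCA-leaves lca₁)))
    ... | inj₂ lca₂ = ⊥-elim (↑ˡ∉T₂ b (proj₂ (LCA-leaves lca₂)))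

leavesL-map-leaf : ∀ {M N} (f : Fin M → Fin N) (L : List (Fin M)) →
                   leavesL (map (λ z → leaf (f z)) L) ≡ map f L
leavesL-map-leaf f []      = refl
leavesL-map-leaf f (z ∷ L) = cong (f z ∷_) (leavesL-map-leaf f L)

All-IsLeaf-map-leaf : ∀ {M N} (f : Fin M → Fin N) (L : List (Fin M)) → All IsLeaf (map (λ z → leaf (f z)) L)
All-IsLeaf-map-leaf f []      = []
All-IsLeaf-map-leaf f (z ∷ L) = isLeaf (f z) ∷ All-IsLeaf-map-leaf f L

leaf-injective : ∀ {N} {x y : Fin N} → leaf x ≡ leaf y → x ≡ y
leaf-injective refl = refl

SkewCotree-joinN-leaves : ∀ {M N} {K : Graph M} (f : Fin M → Fin N) → Injective _≡_ _≡_ f →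
  ∀ {T₀} (L : List (Fin M)) →
  leaves T₀ ++ map f L ↭ map f (allFin M) →
  (∀ x y → x ≢ y → f x ∈ leaves T₀ → f y ∈ leaves T₀ →
     (K x y ≡ true) ⇔ LCA T₀ (f x) (f y) joinN) →
  (∀ x y → x ∈ L → x ≢ y → K x y ≡ true × K y x ≡ true) →
  SkewNF T₀ →
  SkewCotree K f (node joinN T₀ (map (λ z → leaf (f z)) L))
SkewCotree-joinN-leaves {M} {K = K} f f-inj {T₀} L leaves↭′ adjacent₀ universal nf₀ = record
  { leaves↭        = subst (λ ls → leaves T₀ ++ ls ↭ map f (allFin M))
                           (sym (leavesL-map-leaf f L)) leaves↭′
  ; adjacent⇔joinN = λ x y x≢y → mk⇔ (forth x y x≢y) (back x y x≢y)
  ; skewNF         = nf-join nf₀ (All-IsLeaf-map-leaf f L)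
  }
  where
  Ls = map (λ z → leaf (f z)) L
  T = node joinN T₀ Ls
  ∈T₀⊎∈L : ∀ x → f x ∈ leaves T₀ ⊎ x ∈ L
  ∈T₀⊎∈L x with ∈-++⁻ (leaves T₀) (∈-resp-↭ (↭-sym leaves↭′) (∈-map⁺ f (∈-allFin x)))
  ... | inj₁ fx∈T₀ = inj₁ fx∈T₀
  ... | inj₂ fx∈fL with ∈-map⁻ f fx∈fL
  ...   | z , z∈L , eq = inj₂ (subst (_∈ L) (sym (f-inj eq)) z∈L)
  ∈L⇒∈Ls : ∀ {x} → x ∈ L → leaf (f x) ∈ Ls
  ∈L⇒∈Ls = ∈-map⁺ (λ z → leaf (f z))
  ∈Ls⇒∈L : ∀ {t x} → t ∈ Ls → f x ∈ leaves t → x ∈ L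
  ∈Ls⇒∈L t∈ fx∈t with ∈-map⁻ (λ z → leaf (f z)) t∈
  ∈Ls⇒∈L t∈ (here eq) | z , z∈L , refl = subst (_∈ L) (sym (f-inj eq)) z∈L
  ¬LCA-Ls : ∀ {t u v ℓ} → t ∈ Ls → ¬ LCA t u v ℓ
  ¬LCA-Ls t∈ lca with ∈-map⁻ (λ z → leaf (f z)) t∈
  ¬LCA-Ls t∈ () | _ , _ , refl
  position : ∀ {x} (x∈L : x ∈ L) → f x ∈ leaves (lookup Ls (index (∈L⇒∈Ls x∈L)))
  position x∈L = ∈-leaves-lookup-index (∈L⇒∈Ls x∈L) (here refl)
  forth : ∀ x y → x ≢ y → K x y ≡ true → LCA T (f x) (f y) joinN
  forth x y x≢y xy with ∈T₀⊎∈L x | ∈T₀⊎∈L y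
  ... | inj₁ x∈ | inj₁ y∈ = down (here refl) (to (adjacent₀ x y x≢y x∈ y∈) xy)
  ... | inj₁ x∈ | inj₂ y∈ = split zero (suc (index (∈L⇒∈Ls y∈))) (λ ()) x∈ (position y∈)
  ... | inj₂ x∈ | inj₁ y∈ = split (suc (index (∈L⇒∈Ls x∈))) zero (λ ()) (position x∈) y∈
  ... | inj₂ x∈ | inj₂ y∈ = split (suc (index (∈L⇒∈Ls x∈))) (suc (index (∈L⇒∈Ls y∈)))
    (λ eq → x≢y (f-inj (leaf-injective
                          (index-injective (∈L⇒∈Ls x∈) (∈L⇒∈Ls y∈) (suc-injective eq)))))
    (position x∈) (position y∈)
  back : ∀ x y → x ≢ y → LCA T (f x) (f y) joinN → K x y ≡ true
  back x y x≢y (split zero    zero    0≢0 _ _) = ⊥-elim (0≢0 refl)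
  back x y x≢y (split (suc i) _       _ x∈ _)  =
    proj₁ (universal x y (∈Ls⇒∈L (∈-lookup {xs = Ls} i) x∈) x≢y)
  back x y x≢y (split zero    (suc j) _ _ y∈)  =
    proj₂ (universal y x (∈Ls⇒∈L (∈-lookup {xs = Ls} j) y∈) (λ y≡x → x≢y (sym y≡x)))
  back x y x≢y (down (here refl) lca) =
    from (adjacent₀ x y x≢y (proj₁ (LCA-leaves lca)) (proj₂ (LCA-leaves lca))) lca
  back x y x≢y (down (there t∈) lca)  = ⊥-elim (¬LCA-Ls t∈ lca)

Complete : ∀ {m} → Graph m → Set
Complete G = ∀ a b → a ≢ b → G a b ≡ true

complete? : ∀ {m} (G : Graph m) → Complete G ⊎ ∃[ a ] ∃[ b ] (a ≢ b × G a b ≡ false)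
complete? G with any? (λ a → any? (λ b → ¬? (a ≟ b) ×-dec (G a b ≟ᵇ false)))
... | yes (a , b , a≢b , ab) = inj₂ (a , b , a≢b , ab)
... | no ∄nonEdge = inj₁ adjacent
  where
  adjacent : Complete G
  adjacent a b a≢b with G a b in ab
  ... | true  = refl
  ... | false = ⊥-elim (∄nonEdge (a , b , a≢b , ab))

module _ {m n} (G : Graph m) (H : Graph n) where

  ⊕G-completeˡ : Complete G → ∀ a {y} → SplitView m n y → a ↑ˡ n ≢ y →
                 (G ⊕G H) (a ↑ˡ n) y ≡ true × (G ⊕G H) y (a ↑ˡ n) ≡ true
  ⊕G-completeˡ complete a (left b) a≢b =
    trans (⊕G-ll G H a b) (complete a b (λ a≡b → a≢b (cong (_↑ˡ n) a≡b))) ,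
    trans (⊕G-ll G H b a) (complete b a (λ b≡a → a≢b (cong (_↑ˡ n) (sym b≡a))))
  ⊕G-completeˡ complete a (right d) _ = ⊕G-lr G H a d , ⊕G-rl G H d a

  ⊕G-completeʳ : Complete H → ∀ c {y} → SplitView m n y → m ↑ʳ c ≢ y →
                 (G ⊕G H) (m ↑ʳ c) y ≡ true × (G ⊕G H) y (m ↑ʳ c) ≡ true
  ⊕G-completeʳ complete c (left b) _ = ⊕G-rl G H c b , ⊕G-lr G H b c
  ⊕G-completeʳ complete c (right d) c≢d =
    trans (⊕G-rr G H c d) (complete c d (λ c≡d → c≢d (cong (m ↑ʳ_) c≡d))) ,
    trans (⊕G-rr G H d c) (complete d c (λ d≡c → c≢d (cong (m ↑ʳ_) (sym d≡c))))

SkewCotree-⊕G-completeˡ : ∀ {m n N} {G : Graph m} {H : Graph n} (f : Fin (m + n) → Fin N) →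
  Injective _≡_ _≡_ f → Complete G → ∀ {T₂} → SkewCotree H (λ c → f (m ↑ʳ c)) T₂ →
  SkewCotree (G ⊕G H) f (node joinN T₂ (map (λ z → leaf (f z)) (map (_↑ˡ n) (allFin m))))
SkewCotree-⊕G-completeˡ {m} {n} {G = G} {H} f f-inj complete {T₂} ct₂ =
  SkewCotree-joinN-leaves f f-inj (map (_↑ˡ n) (allFin m)) leaves↭′ adjacent universal (skewNF ct₂)
  where
  leaves↭′ = ↭-trans (↭-++⁺ (subst (leaves T₂ ↭_) (map-∘ (allFin n)) (leaves↭ ct₂)) ↭-refl)
                     (↭-trans (++-comm (map f (map (m ↑ʳ_) (allFin n))) _)
                              (map-↑ˡ++map-↑ʳ↭map {m} {n} f))
  adjacent : ∀ x y → x ≢ y → f x ∈ leaves T₂ → f y ∈ leaves T₂ →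
             ((G ⊕G H) x y ≡ true) ⇔ LCA T₂ (f x) (f y) joinN
  adjacent x y x≢y fx∈ fy∈
    with ∈-leaves⇒image (m ↑ʳ_) f-inj (leaves↭ ct₂) fx∈
       | ∈-leaves⇒image (m ↑ʳ_) f-inj (leaves↭ ct₂) fy∈
  ... | c , refl | d , refl =
    ≡⇒true⇔ (⊕G-rr G H c d) (adjacent⇔joinN ct₂ c d (λ c≡d → x≢y (cong (m ↑ʳ_) c≡d)))
  universal : ∀ x y → x ∈ map (_↑ˡ n) (allFin m) → x ≢ y →
              (G ⊕G H) x y ≡ true × (G ⊕G H) y x ≡ true
  universal x y x∈ x≢y with ∈-map⁻ (_↑ˡ n) x∈
  ... | a , _ , refl = ⊕G-completeˡ G H complete a (splitView m n y) x≢y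

SkewCotree-⊕G-completeʳ : ∀ {m n N} {G : Graph m} {H : Graph n} (f : Fin (m + n) → Fin N) →
  Injective _≡_ _≡_ f → Complete H → ∀ {T₁} → SkewCotree G (λ a → f (a ↑ˡ n)) T₁ →
  SkewCotree (G ⊕G H) f (node joinN T₁ (map (λ z → leaf (f z)) (map (m ↑ʳ_) (allFin n))))
SkewCotree-⊕G-completeʳ {m} {n} {G = G} {H} f f-inj complete {T₁} ct₁ =
  SkewCotree-joinN-leaves f f-inj (map (m ↑ʳ_) (allFin n)) leaves↭′ adjacent universal (skewNF ct₁)
  where
  leaves↭′ = ↭-trans (↭-++⁺ (subst (leaves T₁ ↭_) (map-∘ (allFin m)) (leaves↭ ct₁)) ↭-refl)
                     (map-↑ˡ++map-↑ʳ↭map {m} {n} f)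
  adjacent : ∀ x y → x ≢ y → f x ∈ leaves T₁ → f y ∈ leaves T₁ →
             ((G ⊕G H) x y ≡ true) ⇔ LCA T₁ (f x) (f y) joinN
  adjacent x y x≢y fx∈ fy∈
    with ∈-leaves⇒image (_↑ˡ n) f-inj (leaves↭ ct₁) fx∈
       | ∈-leaves⇒image (_↑ˡ n) f-inj (leaves↭ ct₁) fy∈
  ... | a , refl | b , refl =
    ≡⇒true⇔ (⊕G-ll G H a b) (adjacent⇔joinN ct₁ a b (λ a≡b → x≢y (cong (_↑ˡ n) a≡b)))
  universal : ∀ x y → x ∈ map (m ↑ʳ_) (allFin n) → x ≢ y →
              (G ⊕G H) x y ≡ true × (G ⊕G H) y x ≡ true
  universal x y x∈ x≢y with ∈-map⁻ (m ↑ʳ_) x∈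
  ... | c , _ , refl = ⊕G-completeʳ G H complete c (splitView m n y) x≢y

SkewCotree-≅G : ∀ {m n N} {G : Graph m} {H : Graph n} (σ : Fin m ↔ Fin n) →
  (∀ x y → H (Inverse.to σ x) (Inverse.to σ y) ≡ G x y) → (f : Fin n → Fin N) →
  ∀ {T} → SkewCotree G (λ a → f (Inverse.to σ a)) T → SkewCotree H f T
SkewCotree-≅G {m} {H = H} σ preserves f {T} ct = record
  { leaves↭        = ↭-trans (subst (leaves T ↭_) (map-∘ (allFin m)) (leaves↭ ct))
                             (↭-map⁺ f (map-↔↭allFin σ))
  ; adjacent⇔joinN = adjacent
  ; skewNF         = skewNF ct
  }
  where
  open Inverse σ using (strictlyInverseˡ) renaming (to to τ; from to τ⁻¹)
  adjacent : ∀ x y → x ≢ y → (H x y ≡ true) ⇔ LCA T (f x) (f y) joinN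
  adjacent x y x≢y =
    subst₂ (λ u w → (H u w ≡ true) ⇔ LCA T (f u) (f w) joinN) (strictlyInverseˡ x) (strictlyInverseˡ y)
      (≡⇒true⇔ (preserves (τ⁻¹ x) (τ⁻¹ y))
        (adjacent⇔joinN ct (τ⁻¹ x) (τ⁻¹ y)
          (λ eq → x≢y (trans (sym (strictlyInverseˡ x)) (trans (cong τ eq) (strictlyInverseˡ y))))))

nonadjacent-sym : ∀ {m N} {G : Graph m} {f : Fin m → Fin N} {T} → SkewCotree G f T →
                  ∀ {a b} → a ≢ b → G a b ≡ false → G b a ≡ false
nonadjacent-sym {G = G} ct {a} {b} a≢b ab with G b a in ba
... | false = refl
... | true  with () ← trans (sym ab)
                       (from (adjacent⇔joinN ct a b a≢b)
                             (LCA-sym (to (adjacent⇔joinN ct b a (λ b≡a → a≢b (sym b≡a))) ba)))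

HasInducedCycle-embed : ∀ {m M} {G : Graph m} {K : Graph M} (e : Fin m → Fin M) → Injective _≡_ _≡_ e →
                        (∀ a b → K (e a) (e b) ≡ G a b) → HasInducedCycle G → HasInducedCycle K
HasInducedCycle-embed e e-inj induced (k , 4≤k , g , g-inj , cycle) =
  k , 4≤k , (λ i → e (g i)) , (λ eq → g-inj (e-inj eq)) ,
  λ i j i≢j → ≡⇒true⇔ (induced (g i) (g j)) (cycle i j i≢j)

HasInducedCycle-↑ˡ : ∀ {m n} {G : Graph m} (K : Graph (m + n)) →
                     (∀ a b → K (a ↑ˡ n) (b ↑ˡ n) ≡ G a b) → HasInducedCycle G → HasInducedCycle K
HasInducedCycle-↑ˡ {n = n} K = HasInducedCycle-embed {K = K} (_↑ˡ n) (↑ˡ-injective n _ _)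

HasInducedCycle-↑ʳ : ∀ {m n} {H : Graph n} (K : Graph (m + n)) →
                     (∀ c d → K (m ↑ʳ c) (m ↑ʳ d) ≡ H c d) → HasInducedCycle H → HasInducedCycle K
HasInducedCycle-↑ʳ {m} K = HasInducedCycle-embed {K = K} (m ↑ʳ_) (↑ʳ-injective m _ _)

⇔-both : ∀ {b : Bool} {C : Set} → b ≡ true → C → (b ≡ true) ⇔ C
⇔-both b c = mk⇔ (λ _ → c) (λ _ → b)

⇔-neither : ∀ {b : Bool} {C : Set} → b ≡ false → ¬ C → (b ≡ true) ⇔ C
⇔-neither refl ¬c = mk⇔ (λ ()) (λ c → ⊥-elim (¬c c))

-- The cycle runs a, c, b, d: the non-edges ab and cd are its two diagonals.
⊕G-inducedC₄ : ∀ {m n} (G : Graph m) (H : Graph n) {a b : Fin m} {c d : Fin n} →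
  a ≢ b → G a b ≡ false → G b a ≡ false → c ≢ d → H c d ≡ false → H d c ≡ false →
  HasInducedCycle (G ⊕G H)
⊕G-inducedC₄ {m} {n} G H {a} {b} {c} {d} a≢b ab ba c≢d cd dc =
  4 , s≤s (s≤s (s≤s (s≤s z≤n))) , g , g-injective , adjacent
  where
  g : Fin 4 → Fin (m + n)
  g zero                   = a ↑ˡ n
  g (suc zero)             = m ↑ʳ c
  g (suc (suc zero))       = b ↑ˡ n
  g (suc (suc (suc zero))) = m ↑ʳ d
  ↑ˡ≢↑ʳ′ : ∀ {x y} → x ↑ˡ n ≡ m ↑ʳ y → ∀ {A : Set} → A
  ↑ˡ≢↑ʳ′ eq = ⊥-elim (↑ˡ≢↑ʳ m n _ _ eq)
  b≢a : b ≢ a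
  b≢a b≡a = a≢b (sym b≡a)
  d≢c : d ≢ c
  d≢c d≡c = c≢d (sym d≡c)
  g-injective : Injective _≡_ _≡_ g
  g-injective {zero}                   {zero}                   _  = refl
  g-injective {zero}                   {suc zero}               eq = ↑ˡ≢↑ʳ′ eq
  g-injective {zero}                   {suc (suc zero)}         eq = ⊥-elim (a≢b (↑ˡ-injective n a b eq))
  g-injective {zero}                   {suc (suc (suc zero))}   eq = ↑ˡ≢↑ʳ′ eq
  g-injective {suc zero}               {zero}                   eq = ↑ˡ≢↑ʳ′ (sym eq)
  g-injective {suc zero}               {suc zero}               _  = refl
  g-injective {suc zero}               {suc (suc zero)}         eq = ↑ˡ≢↑ʳ′ (sym eq)
  g-injective {suc zero}               {suc (suc (suc zero))}   eq = ⊥-elim (c≢d (↑ʳ-injective m c d eq))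
  g-injective {suc (suc zero)}         {zero}                   eq = ⊥-elim (b≢a (↑ˡ-injective n b a eq))
  g-injective {suc (suc zero)}         {suc zero}               eq = ↑ˡ≢↑ʳ′ eq
  g-injective {suc (suc zero)}         {suc (suc zero)}         _  = refl
  g-injective {suc (suc zero)}         {suc (suc (suc zero))}   eq = ↑ˡ≢↑ʳ′ eq
  g-injective {suc (suc (suc zero))}   {zero}                   eq = ↑ˡ≢↑ʳ′ (sym eq)
  g-injective {suc (suc (suc zero))}   {suc zero}               eq = ⊥-elim (d≢c (↑ʳ-injective m d c eq))
  g-injective {suc (suc (suc zero))}   {suc (suc zero)}         eq = ↑ˡ≢↑ʳ′ (sym eq)
  g-injective {suc (suc (suc zero))}   {suc (suc (suc zero))}   _  = refl
  adjacent : ∀ i j → i ≢ j → ((G ⊕G H) (g i) (g j) ≡ true) ⇔ CycAdj i j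
  adjacent zero                   zero                   i≢j = ⊥-elim (i≢j refl)
  adjacent zero                   (suc zero)             _   = ⇔-both (⊕G-lr G H a c) (inj₁ (inj₁ refl))
  adjacent zero                   (suc (suc zero))       _   = ⇔-neither (trans (⊕G-ll G H a b) ab) ¬CycAdj-0-2
  adjacent zero                   (suc (suc (suc zero))) _   = ⇔-both (⊕G-lr G H a d) (inj₂ (inj₂ (refl , refl)))
  adjacent (suc zero)             zero                   _   = ⇔-both (⊕G-rl G H c a) (inj₂ (inj₁ refl))
  adjacent (suc zero)             (suc zero)             i≢j = ⊥-elim (i≢j refl)
  adjacent (suc zero)             (suc (suc zero))       _   = ⇔-both (⊕G-rl G H c b) (inj₁ (inj₁ refl))
  adjacent (suc zero)             (suc (suc (suc zero))) _   = ⇔-neither (trans (⊕G-rr G H c d) cd) ¬CycAdj-1-3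
  adjacent (suc (suc zero))       zero                   _   =
    ⇔-neither (trans (⊕G-ll G H b a) ba) (λ 2~0 → ¬CycAdj-0-2 (CycAdj-sym 2~0))
  adjacent (suc (suc zero))       (suc zero)             _   = ⇔-both (⊕G-lr G H b c) (inj₂ (inj₁ refl))
  adjacent (suc (suc zero))       (suc (suc zero))       i≢j = ⊥-elim (i≢j refl)
  adjacent (suc (suc zero))       (suc (suc (suc zero))) _   = ⇔-both (⊕G-lr G H b d) (inj₁ (inj₁ refl))
  adjacent (suc (suc (suc zero))) zero                   _   = ⇔-both (⊕G-rl G H d a) (inj₁ (inj₂ (refl , refl)))
  adjacent (suc (suc (suc zero))) (suc zero)             _   =
    ⇔-neither (trans (⊕G-rr G H d c) dc) (λ 3~1 → ¬CycAdj-1-3 (CycAdj-sym 3~1))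
  adjacent (suc (suc (suc zero))) (suc (suc zero))       _   = ⇔-both (⊕G-rl G H d b) (inj₂ (inj₁ refl))
  adjacent (suc (suc (suc zero))) (suc (suc (suc zero))) i≢j = ⊥-elim (i≢j refl)

inducedCycle⊎skewCotree : ∀ {m} {G : Graph m} → IsCograph G → ∀ {N} (f : Fin m → Fin N) →
  Injective _≡_ _≡_ f → HasInducedCycle G ⊎ ∃[ T ] SkewCotree G f T
inducedCycle⊎skewCotree single f f-inj = inj₂ (leaf (f zero) , SkewCotree-K1 f)
inducedCycle⊎skewCotree (union {m} {n} {G} {H} cg ch) f f-inj
  with inducedCycle⊎skewCotree cg (λ a → f (a ↑ˡ n)) (λ eq → ↑ˡ-injective n _ _ (f-inj eq))
     | inducedCycle⊎skewCotree ch (λ c → f (m ↑ʳ c)) (λ eq → ↑ʳ-injective m _ _ (f-inj eq))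
... | inj₁ cycle | _          = inj₁ (HasInducedCycle-↑ˡ (G ∪G H) (∪G-ll G H) cycle)
... | inj₂ _     | inj₁ cycle = inj₁ (HasInducedCycle-↑ʳ (G ∪G H) (∪G-rr G H) cycle)
... | inj₂ (_ , ct₁) | inj₂ (_ , ct₂) = inj₂ (_ , SkewCotree-∪G f f-inj ct₁ ct₂)
inducedCycle⊎skewCotree (join {m} {n} {G} {H} cg ch) f f-inj
  with inducedCycle⊎skewCotree cg (λ a → f (a ↑ˡ n)) (λ eq → ↑ˡ-injective n _ _ (f-inj eq))
     | inducedCycle⊎skewCotree ch (λ c → f (m ↑ʳ c)) (λ eq → ↑ʳ-injective m _ _ (f-inj eq))
... | inj₁ cycle | _          = inj₁ (HasInducedCycle-↑ˡ (G ⊕G H) (⊕G-ll G H) cycle)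
... | inj₂ _     | inj₁ cycle = inj₁ (HasInducedCycle-↑ʳ (G ⊕G H) (⊕G-rr G H) cycle)
... | inj₂ (_ , ct₁) | inj₂ (_ , ct₂) with complete? G | complete? H
...   | inj₁ completeG | _           = inj₂ (_ , SkewCotree-⊕G-completeˡ f f-inj completeG ct₂)
...   | inj₂ _         | inj₁ completeH = inj₂ (_ , SkewCotree-⊕G-completeʳ f f-inj completeH ct₁)
...   | inj₂ (a , b , a≢b , ab) | inj₂ (c , d , c≢d , cd) =
  inj₁ (⊕G-inducedC₄ G H a≢b ab (nonadjacent-sym ct₁ a≢b ab) c≢d cd (nonadjacent-sym ct₂ c≢d cd))
inducedCycle⊎skewCotree (iso {H = H} record { σ = σ ; preserves = preserves } cg) f f-inj
  with inducedCycle⊎skewCotree cg (λ a → f (Inverse.to σ a)) (λ eq → ↔-injective σ (f-inj eq))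
... | inj₁ cycle    = inj₁ (HasInducedCycle-embed {K = H} (Inverse.to σ) (↔-injective σ) preserves cycle)
... | inj₂ (T , ct) = inj₂ (T , SkewCotree-≅G σ preserves f ct)

SkewCotree⇒IsCotree : ∀ {n} {G : Graph n} {T} → SkewCotree G (λ x → x) T → IsCotree G T
SkewCotree⇒IsCotree {n} {T = T} ct = record
  { bijective = subst (leaves T ↭_) (map-id (allFin n)) (leaves↭ ct)
  ; adjacency = adjacent⇔joinN ct
  }

lemma2 : ∀ (n : ℕ) (G : Graph n) → IsCograph G →
    (HasInducedCycle G ⇔ (∀ (T : CoTree n) → IsCotree G T → ¬ Skew T))
lemma2 n G cograph = mk⇔ HasInducedCycle⇒¬Skew noSkewCotree⇒cycle
  where
  noSkewCotree⇒cycle : (∀ T → IsCotree G T → ¬ Skew T) → HasInducedCycle G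
  noSkewCotree⇒cycle noSkew with inducedCycle⊎skewCotree cograph (λ x → x) (λ eq → eq)
  ... | inj₁ cycle   = cycle
  ... | inj₂ (T , ct) = ⊥-elim (noSkew T (SkewCotree⇒IsCotree ct) (SkewNF⇒Skew (skewNF ct)))
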